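{- For every integer $r \geq 5$, $$\sqrt[3r+1]{(2r-8)\,((r-4)!)^2\,((r-1)!)} < \sqrt[r+1]{(r-2)!}.$$ -}

module Defs where

open import Data.Nat using (ℕ; _*_; _∸_; _^_; _<_; _!)

-- The radicand on the left: (2r-8) * ((r-4)!)^2 * (r-1)!
-- (for r ≥ 5 all truncated subtractions are exact)
lhsBase : ℕ → ℕ
lhsBase r = (2 * r ∸ 8) * (((r ∸ 4) !) ^ 2) * ((r ∸ 1) !)

rhsBase : ℕ → ℕ
rhsBase r = (r ∸ 2) !

-- Root comparison  a^(1/p) < b^(1/q)  for positive a, b and p, q ≥ 1,
-- stated without reals: equivalent to  a^q < b^p.
RootLess : (a p b q : ℕ) → Set
RootLess a p b q = a ^ q < b ^ p

{-# OPTIONS --safe #-}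
-- Write r = 5 + m, F = (r-2)!, A = (r-2)(r-3) and c = (2r-8)(r-1). Since
-- (r-4)! A = F and (r-1)! = (r-1) F, the left radicand times A² is c F³,
-- so after multiplying both sides by A^(2(r+1)) the claim becomes
-- c^(r+1) F² < (A²)^(r+1). This follows from c = 2A - 4 < 2A together
-- with 2^(r+1) F² ≤ A^(r+1), and the latter comes from the classical bound
-- n! 2^(n-1) ≤ n^n, itself a consequence of Bernoulli's inequality
-- (1 + 1/n)^n ≥ 2.
module Submission where

open import Defs
open import Data.Nat.Base using (ℕ; zero; suc; _+_; _*_; _∸_; _^_; _!; _≤_; _<_; s≤s; NonZero)
open import Data.Nat.Properties
open import Data.Nat.Tactic.RingSolver using (solve-∀)
open import Relation.Binary.PropositionalEquality
open import Algebra.Properties.CommutativeSemigroup *-commutativeSemigroup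
  using (interchange; x∙yz≈y∙xz; xy∙z≈y∙xz)

-- The ring solver does not read Data.Nat._^_, so the identities proved by
-- solve-∀ below spell out literal powers such as x ^ 2 as x * (x * 1).

^-distribʳ-* : ∀ m n o → (m * n) ^ o ≡ m ^ o * n ^ o
^-distribʳ-* m n zero    = refl
^-distribʳ-* m n (suc o) =
  trans (cong (m * n *_) (^-distribʳ-* m n o)) (interchange m n (m ^ o) (n ^ o))

m^n*[m+n]≤[1+m]^n*m : ∀ m n → m ^ n * (m + n) ≤ suc m ^ n * m
m^n*[m+n]≤[1+m]^n*m m zero    = ≤-reflexive (cong (_+ 0) (+-identityʳ m))
m^n*[m+n]≤[1+m]^n*m m (suc n) = begin
    m * m ^ n * (m + suc n)
  ≤⟨ m≤m+n _ (m ^ n * n) ⟩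
    m * m ^ n * (m + suc n) + m ^ n * n
  ≡⟨ regroup m n (m ^ n) ⟩
    suc m * (m ^ n * (m + n))
  ≤⟨ *-monoʳ-≤ (suc m) (m^n*[m+n]≤[1+m]^n*m m n) ⟩
    suc m * (suc m ^ n * m)
  ≡⟨ *-assoc (suc m) (suc m ^ n) m ⟨
    suc m * suc m ^ n * m
  ∎
  where
  open ≤-Reasoning
  regroup : ∀ m n x → m * x * (m + suc n) + x * n ≡ suc m * (x * (m + n))
  regroup = solve-∀

2*[1+n]^[1+n]≤[2+n]^[1+n] : ∀ n → 2 * suc n ^ suc n ≤ suc (suc n) ^ suc n
2*[1+n]^[1+n]≤[2+n]^[1+n] n = *-cancelʳ-≤ _ _ (suc n) (begin
    2 * suc n ^ suc n * suc n
  ≡⟨ regroup (suc n ^ suc n) (suc n) ⟩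
    suc n ^ suc n * (suc n + suc n)
  ≤⟨ m^n*[m+n]≤[1+m]^n*m (suc n) (suc n) ⟩
    suc (suc n) ^ suc n * suc n
  ∎)
  where
  open ≤-Reasoning
  regroup : ∀ x k → 2 * x * k ≡ x * (k + k)
  regroup = solve-∀

[1+n]!*2^n≤[1+n]^[1+n] : ∀ n → suc n ! * 2 ^ n ≤ suc n ^ suc n
[1+n]!*2^n≤[1+n]^[1+n] zero    = ≤-refl
[1+n]!*2^n≤[1+n]^[1+n] (suc n) = begin
    suc (suc n) * suc n ! * (2 * 2 ^ n)
  ≡⟨ regroup (suc (suc n)) (suc n !) (2 ^ n) ⟩
    suc (suc n) * (2 * (suc n ! * 2 ^ n))
  ≤⟨ *-monoʳ-≤ (suc (suc n)) (*-monoʳ-≤ 2 ([1+n]!*2^n≤[1+n]^[1+n] n)) ⟩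
    suc (suc n) * (2 * suc n ^ suc n)
  ≤⟨ *-monoʳ-≤ (suc (suc n)) (2*[1+n]^[1+n]≤[2+n]^[1+n] n) ⟩
    suc (suc n) * suc (suc n) ^ suc n
  ∎
  where
  open ≤-Reasoning
  regroup : ∀ a b c → a * b * (2 * c) ≡ a * (2 * (b * c))
  regroup = solve-∀

c^E*F^2<[A*A]^E : ∀ {c A F} E .{{_ : NonZero E}} .{{_ : NonZero F}} →
  c < 2 * A → 2 ^ E * F ^ 2 ≤ A ^ E → c ^ E * F ^ 2 < (A * A) ^ E
c^E*F^2<[A*A]^E {c} {A} {F} E c<2A 2^E*F^2≤A^E = begin-strict
    c ^ E * F ^ 2
  <⟨ *-monoˡ-< (F ^ 2) {{m^n≢0 F 2}} (^-monoˡ-< E c<2A) ⟩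
    (2 * A) ^ E * F ^ 2
  ≡⟨ cong (_* F ^ 2) (^-distribʳ-* 2 A E) ⟩
    2 ^ E * A ^ E * F ^ 2
  ≡⟨ xy∙z≈y∙xz (2 ^ E) (A ^ E) (F ^ 2) ⟩
    A ^ E * (2 ^ E * F ^ 2)
  ≤⟨ *-monoʳ-≤ (A ^ E) 2^E*F^2≤A^E ⟩
    A ^ E * A ^ E
  ≡⟨ ^-distribʳ-* A A E ⟨
    (A * A) ^ E
  ∎
  where open ≤-Reasoning

rootLess-from-scaling : ∀ {L K c F} r .{{_ : NonZero F}} →
  L * K ≡ c * F ^ 3 → c ^ suc r * F ^ 2 < K ^ suc r →
  RootLess L (3 * r + 1) F (r + 1)
rootLess-from-scaling {L} {K} {c} {F} r L*K≡c*F^3 c^[1+r]*F^2<K^[1+r] rewrite +-comm r 1 =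
  *-cancelʳ-< (K ^ suc r) (L ^ suc r) (F ^ (3 * r + 1)) (begin-strict
    L ^ suc r * K ^ suc r
  ≡⟨ ^-distribʳ-* L K (suc r) ⟨
    (L * K) ^ suc r
  ≡⟨ cong (_^ suc r) L*K≡c*F^3 ⟩
    (c * F ^ 3) ^ suc r
  ≡⟨ ^-distribʳ-* c (F ^ 3) (suc r) ⟩
    c ^ suc r * (F ^ 3) ^ suc r
  ≡⟨ cong (c ^ suc r *_) (^-*-assoc F 3 (suc r)) ⟩
    c ^ suc r * F ^ (3 * suc r)
  ≡⟨ cong (λ e → c ^ suc r * F ^ e) (three-times-suc r) ⟩
    c ^ suc r * F ^ (2 + (3 * r + 1))
  ≡⟨ cong (c ^ suc r *_) (^-distribˡ-+-* F 2 (3 * r + 1)) ⟩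
    c ^ suc r * (F ^ 2 * F ^ (3 * r + 1))
  ≡⟨ *-assoc (c ^ suc r) (F ^ 2) (F ^ (3 * r + 1)) ⟨
    c ^ suc r * F ^ 2 * F ^ (3 * r + 1)
  <⟨ *-monoˡ-< (F ^ (3 * r + 1)) {{m^n≢0 F (3 * r + 1)}} c^[1+r]*F^2<K^[1+r] ⟩
    K ^ suc r * F ^ (3 * r + 1)
  ≡⟨ *-comm (K ^ suc r) (F ^ (3 * r + 1)) ⟩
    F ^ (3 * r + 1) * K ^ suc r
  ∎)
  where
  open ≤-Reasoning
  three-times-suc : ∀ r → 3 * suc r ≡ 2 + (3 * r + 1)
  three-times-suc = solve-∀

lhsBase-scaling : ∀ m →
  lhsBase (5 + m) * ((3 + m) * (2 + m) * ((3 + m) * (2 + m)))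
    ≡ (2 + 2 * m) * (4 + m) * ((3 + m) !) ^ 3
lhsBase-scaling m = begin
    (2 * (5 + m) ∸ 8) * G ^ 2 * (4 + m) ! * (A * A)
  ≡⟨ cong (λ k → k * G ^ 2 * (4 + m) ! * (A * A)) 2*[5+m]∸8≡2+2m ⟩
    (2 + 2 * m) * G ^ 2 * (4 + m) ! * (A * A)
  ≡⟨ regroup (2 + 2 * m) (4 + m) (3 + m) (2 + m) G ⟩
    (2 + 2 * m) * (4 + m) * ((3 + m) !) ^ 3
  ∎
  where
  open ≡-Reasoning
  G A : ℕ
  G = (1 + m) !
  A = (3 + m) * (2 + m)

  2*[5+m]∸8≡2+2m : 2 * (5 + m) ∸ 8 ≡ 2 + 2 * m
  2*[5+m]∸8≡2+2m = trans (cong (_∸ 8) (split m)) (m+n∸m≡n 8 (2 + 2 * m))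
    where
    split : ∀ m → 2 * (5 + m) ≡ 8 + (2 + 2 * m)
    split = solve-∀

  regroup : ∀ a b x y g →
    a * (g * (g * 1)) * (b * (x * (y * g))) * (x * y * (x * y))
      ≡ a * b * (x * (y * g) * (x * (y * g) * (x * (y * g) * 1)))
  regroup = solve-∀

[2+2m]*[4+m]<2*[[3+m]*[2+m]] : ∀ m → (2 + 2 * m) * (4 + m) < 2 * ((3 + m) * (2 + m))
[2+2m]*[4+m]<2*[[3+m]*[2+m]] m = ≤-trans (m≤m+n _ 3) (≤-reflexive (gap m))
  where
  gap : ∀ m → suc ((2 + 2 * m) * (4 + m)) + 3 ≡ 2 * ((3 + m) * (2 + m))
  gap = solve-∀

-- Multiplying by W = 2^(2+m) makes (F W)² appear, to which n! 2^(n-1) ≤ n^n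
-- applies with n = 3 + m.
2^[6+m]*[3+m]!^2≤[[3+m]*[2+m]]^[6+m] : ∀ m →
  2 ^ (6 + m) * ((3 + m) !) ^ 2 ≤ ((3 + m) * (2 + m)) ^ (6 + m)
2^[6+m]*[3+m]!^2≤[[3+m]*[2+m]]^[6+m] m = *-cancelʳ-≤ _ _ W {{m^n≢0 2 (2 + m)}} (begin
    2 ^ (6 + m) * F ^ 2 * W
  ≡⟨ cong (λ x → x * F ^ 2 * W) (^-distribˡ-+-* 2 4 (2 + m)) ⟩
    16 * W * F ^ 2 * W
  ≡⟨ square-regroup 16 W F ⟩
    16 * (F * W) ^ 2
  ≤⟨ *-monoʳ-≤ 16 (^-monoˡ-≤ 2 ([1+n]!*2^n≤[1+n]^[1+n] (2 + m))) ⟩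
    16 * (P ^ (3 + m)) ^ 2
  ≡⟨ cong (16 *_) P^[3+m]^2≡P^[6+m]*P^m ⟩
    16 * (P ^ (6 + m) * P ^ m)
  ≡⟨ x∙yz≈y∙xz 16 (P ^ (6 + m)) (P ^ m) ⟩
    P ^ (6 + m) * (16 * P ^ m)
  ≤⟨ *-monoʳ-≤ (P ^ (6 + m)) 16*P^m≤W*Q^[6+m] ⟩
    P ^ (6 + m) * (W * Q ^ (6 + m))
  ≡⟨ x∙yz≈y∙xz (P ^ (6 + m)) W (Q ^ (6 + m)) ⟩
    W * (P ^ (6 + m) * Q ^ (6 + m))
  ≡⟨ cong (W *_) (^-distribʳ-* P Q (6 + m)) ⟨
    W * (P * Q) ^ (6 + m)
  ≡⟨ *-comm W _ ⟩
    (P * Q) ^ (6 + m) * W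
  ∎)
  where
  open ≤-Reasoning
  P Q F W : ℕ
  P = 3 + m
  Q = 2 + m
  F = P !
  W = 2 ^ (2 + m)

  square-regroup : ∀ k w x → k * w * (x * (x * 1)) * w ≡ k * (x * w * (x * w * 1))
  square-regroup = solve-∀

  P^[3+m]^2≡P^[6+m]*P^m : (P ^ (3 + m)) ^ 2 ≡ P ^ (6 + m) * P ^ m
  P^[3+m]^2≡P^[6+m]*P^m = begin-equality
      (P ^ (3 + m)) ^ 2
    ≡⟨ ^-*-assoc P (3 + m) 2 ⟩
      P ^ ((3 + m) * 2)
    ≡⟨ cong (P ^_) (double m) ⟩
      P ^ (6 + m + m)
    ≡⟨ ^-distribˡ-+-* P (6 + m) m ⟩
      P ^ (6 + m) * P ^ m
    ∎
    where
    double : ∀ m → (3 + m) * 2 ≡ 6 + m + m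
    double = solve-∀

  16*P^m≤W*Q^[6+m] : 16 * P ^ m ≤ W * Q ^ (6 + m)
  16*P^m≤W*Q^[6+m] = begin
      16 * P ^ m
    ≤⟨ *-mono-≤ 16≤4*Q^6 (^-monoˡ-≤ m P≤2*Q) ⟩
      4 * Q ^ 6 * (2 * Q) ^ m
    ≡⟨ cong (4 * Q ^ 6 *_) (^-distribʳ-* 2 Q m) ⟩
      4 * Q ^ 6 * (2 ^ m * Q ^ m)
    ≡⟨ interchange 4 (Q ^ 6) (2 ^ m) (Q ^ m) ⟩
      4 * 2 ^ m * (Q ^ 6 * Q ^ m)
    ≡⟨ cong₂ _*_ (^-distribˡ-+-* 2 2 m) (^-distribˡ-+-* Q 6 m) ⟨
      W * Q ^ (6 + m)
    ∎
    where
    16≤4*Q^6 : 16 ≤ 4 * Q ^ 6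
    16≤4*Q^6 = *-monoʳ-≤ 4 (≤-trans (m≤m+n 4 60) (^-monoˡ-≤ 6 (m≤m+n 2 m)))

    P≤2*Q : P ≤ 2 * Q
    P≤2*Q = ≤-trans (m≤m+n P (suc m)) (≤-reflexive (twice m))
      where
      twice : ∀ m → 3 + m + suc m ≡ 2 * (2 + m)
      twice = solve-∀

mainTheorem5 : (r : ℕ) → 5 ≤ r →
    RootLess (lhsBase r) (3 * r + 1) (rhsBase r) (r + 1)
mainTheorem5 r@(suc (suc (suc (suc (suc m))))) (s≤s (s≤s (s≤s (s≤s (s≤s _))))) =
  rootLess-from-scaling {L = lhsBase r} r {{(3 + m) !≢0}} (lhsBase-scaling m)
    (c^E*F^2<[A*A]^E (6 + m) {{_}} {{(3 + m) !≢0}}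
      ([2+2m]*[4+m]<2*[[3+m]*[2+m]] m)
      (2^[6+m]*[3+m]!^2≤[[3+m]*[2+m]]^[6+m] m))
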